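{- If $G$ is a graph that has exactly three odd cycles, then the intersection of every two of its odd cycles is either empty or is a path.
   Context: Graphs are finite and simple; an odd cycle of $G$ is a cycle subgraph of $G$ of odd length. A path may consist of a single vertex. -}

module Defs where

open import Data.Nat using (ℕ; zero; suc; _+_; _%_)
open import Data.Fin using (Fin; toℕ)
open import Data.Fin.Subset using (Subset; _∈_; _∉_; _∩_)
open import Data.Vec using (Vec; lookup; zipWith)
open import Data.Product using (Σ; ∃; ∃-syntax; _×_; _,_)
open import Data.Sum using (_⊎_)
open import Relation.Binary.PropositionalEquality using (_≡_; _≢_)
open import Relation.Nullary using (¬_)
open import Function using (Injective; _⇔_)

record Graph (n : ℕ) : Set₁ where
  field
    Adj    : Fin n → Fin n → Set
    sym    : ∀ {x y} → Adj x y → Adj y x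
    irrefl : ∀ {x} → ¬ Adj x x
open Graph public

-- Edge sets on Fin n, stored as adjacency matrices of booleans
-- (row x is the subset of neighbours of x).
EdgeSet : ℕ → Set
EdgeSet n = Vec (Subset n) n

_∈ₑ_ : ∀ {n} → Fin n × Fin n → EdgeSet n → Set
(x , y) ∈ₑ E = y ∈ lookup E x

record Subgraph (n : ℕ) : Set where
  constructor mkSub
  field
    verts : Subset n
    edges : EdgeSet n
open Subgraph public

_∩ᵍ_ : ∀ {n} → Subgraph n → Subgraph n → Subgraph n
H ∩ᵍ K = mkSub (verts H ∩ verts K) (zipWith _∩_ (edges H) (edges K))

SameEdge : ∀ {n} → Fin n → Fin n → Fin n → Fin n → Set
SameEdge x y a b = (x ≡ a × y ≡ b) ⊎ (x ≡ b × y ≡ a)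

-- H is the cycle v_0 v_1 ... v_{k-1} v_0 of length k = 3 + m
-- (distinct vertices; exactly the vertices v_i and edges v_i v_{i+1 mod k}).
IsCycleOn : ∀ {n} (m : ℕ) → (Fin (3 + m) → Fin n) → Subgraph n → Set
IsCycleOn m v H =
  Injective _≡_ _≡_ v
  × (∀ x → (x ∈ verts H) ⇔ (∃[ i ] x ≡ v i))
  × (∀ x y → ((x , y) ∈ₑ edges H) ⇔
        (∃[ i ] ∃[ j ] (toℕ j ≡ suc (toℕ i) % (3 + m)) × SameEdge x y (v i) (v j)))

IsCycleOfLength : ∀ {n} → Graph n → ℕ → Subgraph n → Set
IsCycleOfLength {n} G m H =
  Σ (Fin (3 + m) → Fin n) λ v →
    IsCycleOn m v H
    × (∀ i j → toℕ j ≡ suc (toℕ i) % (3 + m) → Adj G (v i) (v j))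

IsOddCycle : ∀ {n} → Graph n → Subgraph n → Set
IsOddCycle G H = ∃[ m ] (IsCycleOfLength G m H × (3 + m) % 2 ≡ 1)

-- H is a path v_0 v_1 ... v_m (m ≥ 0; a single vertex is a path):
-- distinct vertices, exactly the vertices v_i and edges v_i v_{i+1}.
IsPath : ∀ {n} → Subgraph n → Set
IsPath {n} H =
  ∃[ m ] Σ (Fin (suc m) → Fin n) λ v →
    Injective _≡_ _≡_ v
    × (∀ x → (x ∈ verts H) ⇔ (∃[ i ] x ≡ v i))
    × (∀ x y → ((x , y) ∈ₑ edges H) ⇔
          (∃[ i ] ∃[ j ] (toℕ j ≡ suc (toℕ i)) × SameEdge x y (v i) (v j)))

IsEmpty : ∀ {n} → Subgraph n → Set
IsEmpty H = (∀ x → x ∉ verts H) × (∀ x y → ¬ ((x , y) ∈ₑ edges H))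

HasExactlyThreeOddCycles : ∀ {n} → Graph n → Set
HasExactlyThreeOddCycles G =
  ∃[ C₁ ] ∃[ C₂ ] ∃[ C₃ ]
    IsOddCycle G C₁ × IsOddCycle G C₂ × IsOddCycle G C₃
    × C₁ ≢ C₂ × C₁ ≢ C₃ × C₂ ≢ C₃
    × (∀ C → IsOddCycle G C → C ≡ C₁ ⊎ C ≡ C₂ ⊎ C ≡ C₃)

module Submission where

-- Walk along D from a vertex of C to a point where D leaves
-- C.  From there D runs through an ear of C: a path from a to b whose
-- inner vertices avoid C and which is not an edge of C.  The two arcs
-- of C between a and b have lengths of different parity, so the ear
-- closes up with one of them to a new odd cycle (earCycle).  If D meets C
-- only in a, C ∩ D is that vertex; if the rest of D runs along C, C ∩ D
-- is that rest, a path; otherwise D contains a second ear, and the two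
-- ear cycles with C and D are four distinct odd cycles, too many.  If D
-- never leaves C, all its edges are edges of C; if this also holds with
-- C and D exchanged, then C = D (meet, lemma2p3).

open import Defs hiding (sym)
open import Data.Nat using (ℕ; zero; suc; _+_; _%_; _≤_; _<_; s≤s; z≤n)
import Data.Nat.Properties as ℕₚ
open import Data.Nat.DivMod using (m<n⇒m%n≡m; n%n≡0)
open import Data.Bool using (Bool; true; false; not; _xor_)
open import Data.Bool.Properties using (not-involutive)
open import Data.Fin as Fin using (Fin; toℕ; fromℕ; _≟_)
import Data.Fin.Properties as Finₚ
open import Data.Fin.Subset using (_∩_; _⊆_) renaming (_∈_ to _∈ₛ_)
import Data.Fin.Subset.Properties as Subsetₚ
open import Data.List using (List; []; _∷_; _++_; [_]; length; reverse; tabulate; lookup)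
import Data.List.Properties as Listₚ
open import Data.List.Membership.Propositional using (_∈_; _∉_; find; lose)
import Data.List.Membership.Propositional.Properties as ∈ₚ
open import Data.List.Relation.Unary.Any using (Any; here; there; any?)
open import Data.List.Relation.Unary.All as All using (All; []; _∷_)
import Data.List.Relation.Unary.All.Properties as Allₚ
open import Data.List.Relation.Unary.Unique.Propositional using (Unique; []; _∷_)
import Data.List.Relation.Unary.Unique.Propositional.Properties as Uniqueₚ
open import Data.List.Relation.Binary.Disjoint.Propositional using (Disjoint)
open import Data.List.Relation.Binary.Permutation.Propositional using (_↭_; ↭-sym; ↭⇒↭ₛ)
open import Data.List.Relation.Binary.Permutation.Propositional.Properties using (++-comm; ↭-reverse; ∈-resp-↭)
import Data.List.Relation.Binary.Permutation.Setoid.Properties as Permₛ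
import Data.Vec as Vec
import Data.Vec.Properties as Vecₚ
open import Data.Product using (Σ; ∃; _×_; _,_; proj₁; proj₂)
open import Data.Sum using (_⊎_; inj₁; inj₂; [_,_]′; swap; map₁)
open import Data.Empty using (⊥; ⊥-elim)
open import Relation.Binary.PropositionalEquality using (_≡_; _≢_; ≢-sym; refl; sym; trans; cong; cong₂; subst; setoid; module ≡-Reasoning)
open import Relation.Nullary using (¬_; Dec; yes; no; does)
open import Relation.Nullary.Decidable using (_×-dec_; _⊎-dec_; dec-true)
open import Function using (Injective; _⇔_; mk⇔; Equivalence)
open import Function.Construct.Composition using (_⇔-∘_)

-- Cycles and paths are handled as duplicate-free lists of vertices.
module _ {A : Set} where

  Unique-++⁻ : ∀ (xs : List A) {ys} → Unique (xs ++ ys) →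
               Unique xs × Unique ys × Disjoint xs ys
  Unique-++⁻ []       u          = [] , u , λ { (() , _) }
  Unique-++⁻ (x ∷ xs) (x≢ ∷ u) with Unique-++⁻ xs u
  ... | uxs , uys , xs#ys =
    Allₚ.++⁻ˡ xs x≢ ∷ uxs , uys ,
    λ { (here refl , y∈ys) → All.lookup (Allₚ.++⁻ʳ xs x≢) y∈ys refl
      ; (there v∈xs , v∈ys) → xs#ys (v∈xs , v∈ys) }

  Unique-↭ : ∀ {xs ys : List A} → xs ↭ ys → Unique xs → Unique ys
  Unique-↭ p = Permₛ.Unique-resp-↭ (setoid A) (↭⇒↭ₛ p)

  Unique-rotate : ∀ (xs ys : List A) → Unique (xs ++ ys) → Unique (ys ++ xs)
  Unique-rotate xs ys = Unique-↭ (++-comm xs ys)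

  Unique-reverse : ∀ (xs : List A) → Unique xs → Unique (reverse xs)
  Unique-reverse xs = Unique-↭ (↭-sym (↭-reverse xs))

  lookup-injective : ∀ (xs : List A) → Unique xs → Injective _≡_ _≡_ (lookup xs)
  lookup-injective (x ∷ xs) u         {Fin.zero}  {Fin.zero}  _  = refl
  lookup-injective (x ∷ xs) (x≢ ∷ _) {Fin.zero}  {Fin.suc j} eq = ⊥-elim (All.lookup x≢ (∈ₚ.∈-lookup j) eq)
  lookup-injective (x ∷ xs) (x≢ ∷ _) {Fin.suc i} {Fin.zero}  eq = ⊥-elim (All.lookup x≢ (∈ₚ.∈-lookup i) (sym eq))
  lookup-injective (x ∷ xs) (_ ∷ u)  {Fin.suc i} {Fin.suc j} eq = cong Fin.suc (lookup-injective xs u eq)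

  Unique-arcs : ∀ (a : A) P b Q → Unique (a ∷ P ++ b ∷ Q) →
                Unique (a ∷ P ++ [ b ]) × Unique (b ∷ Q ++ [ a ])
  Unique-arcs a P b Q u =
    proj₁ (Unique-++⁻ (a ∷ P ++ [ b ]) (subst Unique (cong (a ∷_) (sym (Listₚ.++-assoc P [ b ] Q))) u)) ,
    proj₁ (Unique-++⁻ (b ∷ Q ++ [ a ])
      (subst Unique (cong (b ∷_) (sym (Listₚ.++-assoc Q [ a ] P))) (Unique-rotate (a ∷ P) (b ∷ Q) u)))

  ∈-arcs⁻ : ∀ {x : A} a P b Q → x ∈ a ∷ P ++ b ∷ Q → x ∈ P ⊎ x ∈ b ∷ Q ++ [ a ]
  ∈-arcs⁻ a P b Q (here refl) = inj₂ (there (∈ₚ.∈-++⁺ʳ Q (here refl)))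
  ∈-arcs⁻ a P b Q (there x∈) with ∈ₚ.∈-++⁻ P x∈
  ... | inj₁ x∈P         = inj₁ x∈P
  ... | inj₂ (here refl) = inj₂ (here refl)
  ... | inj₂ (there x∈Q) = inj₂ (there (∈ₚ.∈-++⁺ˡ x∈Q))

  ∈-arcʳ⁺ : ∀ {x : A} a P b Q → x ∈ b ∷ Q ++ [ a ] → x ∈ a ∷ P ++ b ∷ Q
  ∈-arcʳ⁺ a P b Q (here refl) = there (∈ₚ.∈-++⁺ʳ P (here refl))
  ∈-arcʳ⁺ a P b Q (there x∈) with ∈ₚ.∈-++⁻ Q x∈
  ... | inj₁ x∈Q         = there (∈ₚ.∈-++⁺ʳ P (there x∈Q))
  ... | inj₂ (here refl) = here refl

  split-∷ʳ : ∀ (xs : List A) z P a c r → xs ++ [ z ] ≡ P ++ a ∷ c ∷ r →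
             ∃ λ s → (xs ≡ P ++ a ∷ s) × (c ∷ r ≡ s ++ [ z ])
  split-∷ʳ []       z []           a c r ()
  split-∷ʳ []       z (p ∷ [])     a c r ()
  split-∷ʳ []       z (p ∷ p' ∷ P) a c r ()
  split-∷ʳ (x ∷ xs) z []           a c r eq with Listₚ.∷-injective eq
  ... | refl , rest = xs , refl , sym rest
  split-∷ʳ (x ∷ xs) z (p ∷ P)      a c r eq with Listₚ.∷-injective eq
  ... | refl , rest with split-∷ʳ xs z P a c r rest
  ... | s , e₁ , e₂ = s , cong (x ∷_) e₁ , e₂

  -- If a c is a step of the closed walk x ∷ w, then rotating the walk to
  -- start at a makes c the next entry (cyclically).
  rotate-to-step : ∀ (x : A) w P a c r → x ∷ w ++ [ x ] ≡ P ++ a ∷ c ∷ r →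
                   ∃ λ Q → ∃ λ S → (x ∷ w ≡ Q ++ a ∷ S) × ∃ λ r' → S ++ Q ++ [ a ] ≡ c ∷ r'
  rotate-to-step x w P a c r eq with split-∷ʳ (x ∷ w) x P a c r eq
  ... | s , x∷w≡ , c∷r≡ = P , s , x∷w≡ , next s x∷w≡ c∷r≡
    where
    next : ∀ s → x ∷ w ≡ P ++ a ∷ s → c ∷ r ≡ s ++ [ x ] → ∃ λ r' → s ++ P ++ [ a ] ≡ c ∷ r'
    next []       x∷w≡ c∷r≡ with Listₚ.∷-injective c∷r≡
    ... | refl , _ = w , sym x∷w≡
    next (c' ∷ s) _    c∷r≡ with Listₚ.∷-injective c∷r≡
    ... | refl , _ = s ++ P ++ [ a ] , refl

module _ {n : ℕ} where

  PathEdge : List (Fin n) → Fin n → Fin n → Set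
  PathEdge []          u w = ⊥
  PathEdge (x ∷ [])    u w = ⊥
  PathEdge (x ∷ y ∷ t) u w = SameEdge u w x y ⊎ PathEdge (y ∷ t) u w

  CycleEdge : List (Fin n) → Fin n → Fin n → Set
  CycleEdge []      u w = ⊥
  CycleEdge (x ∷ t) u w = PathEdge (x ∷ t ++ [ x ]) u w

  SameEdge-sym : ∀ {u w a b : Fin n} → SameEdge u w a b → SameEdge w u a b
  SameEdge-sym (inj₁ (p , q)) = inj₂ (q , p)
  SameEdge-sym (inj₂ (p , q)) = inj₁ (q , p)

  SameEdge-flip : ∀ {u w a b : Fin n} → SameEdge u w a b → SameEdge u w b a
  SameEdge-flip (inj₁ (p , q)) = inj₂ (p , q)
  SameEdge-flip (inj₂ (p , q)) = inj₁ (p , q)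

  SameEdge-swap : ∀ {u w a b : Fin n} → SameEdge u w a b → SameEdge a b u w
  SameEdge-swap (inj₁ (p , q)) = inj₁ (sym p , sym q)
  SameEdge-swap (inj₂ (p , q)) = inj₂ (sym q , sym p)

  -- Consecutiveness is decidable; this is what allows a list to define
  -- the edge set of a subgraph.
  SameEdge? : ∀ (u w a b : Fin n) → Dec (SameEdge u w a b)
  SameEdge? u w a b = (u ≟ a ×-dec w ≟ b) ⊎-dec (u ≟ b ×-dec w ≟ a)

  PathEdge? : ∀ L u w → Dec (PathEdge L u w)
  PathEdge? []          u w = no λ ()
  PathEdge? (x ∷ [])    u w = no λ ()
  PathEdge? (x ∷ y ∷ t) u w = SameEdge? u w x y ⊎-dec PathEdge? (y ∷ t) u w

  CycleEdge? : ∀ L u w → Dec (CycleEdge L u w)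
  CycleEdge? []      u w = no λ ()
  CycleEdge? (x ∷ t) u w = PathEdge? (x ∷ t ++ [ x ]) u w

  PathEdge-sym : ∀ L {u w} → PathEdge L u w → PathEdge L w u
  PathEdge-sym (x ∷ y ∷ t) (inj₁ s) = inj₁ (SameEdge-sym s)
  PathEdge-sym (x ∷ y ∷ t) (inj₂ p) = inj₂ (PathEdge-sym (y ∷ t) p)

  PathEdge-∈ : ∀ L {u w} → PathEdge L u w → u ∈ L × w ∈ L
  PathEdge-∈ (x ∷ y ∷ t) (inj₁ (inj₁ (refl , refl))) = here refl , there (here refl)
  PathEdge-∈ (x ∷ y ∷ t) (inj₁ (inj₂ (refl , refl))) = there (here refl) , here refl
  PathEdge-∈ (x ∷ y ∷ t) (inj₂ p) with PathEdge-∈ (y ∷ t) p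
  ... | u∈ , w∈ = there u∈ , there w∈

  CycleEdge-∈ : ∀ L {u w} → CycleEdge L u w → u ∈ L × w ∈ L
  CycleEdge-∈ (x ∷ t) p with PathEdge-∈ (x ∷ t ++ [ x ]) p
  ... | u∈ , w∈ = closing u∈ , closing w∈
    where
    closing : ∀ {v} → v ∈ x ∷ t ++ [ x ] → v ∈ x ∷ t
    closing (here e) = here e
    closing (there q) with ∈ₚ.∈-++⁻ t q
    ... | inj₁ r        = there r
    ... | inj₂ (here e) = here e

  PathEdge-at : ∀ (b : Fin n) s a {x} → x ∈ b ∷ s ++ [ a ] → ∃ λ w → PathEdge (b ∷ s ++ [ a ]) x w
  PathEdge-at b []      a (here refl)         = a , inj₁ (inj₁ (refl , refl))
  PathEdge-at b []      a (there (here refl)) = b , inj₁ (inj₂ (refl , refl))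
  PathEdge-at b (z ∷ s) a (here refl)         = z , inj₁ (inj₁ (refl , refl))
  PathEdge-at b (z ∷ s) a (there x∈) with PathEdge-at z s a x∈
  ... | w , p = w , inj₂ p

  PathEdge-++⁻ : ∀ A y M {u w} → PathEdge (A ++ y ∷ M) u w →
                 PathEdge (A ++ [ y ]) u w ⊎ PathEdge (y ∷ M) u w
  PathEdge-++⁻ []           y M p        = inj₂ p
  PathEdge-++⁻ (x ∷ [])     y M (inj₁ s) = inj₁ (inj₁ s)
  PathEdge-++⁻ (x ∷ [])     y M (inj₂ p) = inj₂ p
  PathEdge-++⁻ (x ∷ x' ∷ A) y M (inj₁ s) = inj₁ (inj₁ s)
  PathEdge-++⁻ (x ∷ x' ∷ A) y M (inj₂ p) with PathEdge-++⁻ (x' ∷ A) y M p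
  ... | inj₁ q = inj₁ (inj₂ q)
  ... | inj₂ q = inj₂ q

  PathEdge-++⁺ˡ : ∀ A y M {u w} → PathEdge (A ++ [ y ]) u w → PathEdge (A ++ y ∷ M) u w
  PathEdge-++⁺ˡ (x ∷ [])     y M (inj₁ s) = inj₁ s
  PathEdge-++⁺ˡ (x ∷ x' ∷ A) y M (inj₁ s) = inj₁ s
  PathEdge-++⁺ˡ (x ∷ x' ∷ A) y M (inj₂ p) = inj₂ (PathEdge-++⁺ˡ (x' ∷ A) y M p)

  PathEdge-++⁺ʳ : ∀ A y M {u w} → PathEdge (y ∷ M) u w → PathEdge (A ++ y ∷ M) u w
  PathEdge-++⁺ʳ []           y M p = p
  PathEdge-++⁺ʳ (x ∷ [])     y M p = inj₂ p
  PathEdge-++⁺ʳ (x ∷ x' ∷ A) y M p = inj₂ (PathEdge-++⁺ʳ (x' ∷ A) y M p)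

  reverse-∷∷ : ∀ (x y : Fin n) t → reverse (x ∷ y ∷ t) ≡ reverse t ++ y ∷ [ x ]
  reverse-∷∷ x y t = trans (Listₚ.unfold-reverse x (y ∷ t))
    (trans (cong (_++ [ x ]) (Listₚ.unfold-reverse y t)) (Listₚ.++-assoc (reverse t) [ y ] [ x ]))

  PathEdge-reverse : ∀ L {u w} → PathEdge L u w → PathEdge (reverse L) u w
  PathEdge-reverse (x ∷ y ∷ t) {u} {w} p rewrite reverse-∷∷ x y t = go p
    where
    go : PathEdge (x ∷ y ∷ t) u w → PathEdge (reverse t ++ y ∷ [ x ]) u w
    go (inj₁ s) = PathEdge-++⁺ʳ (reverse t) y [ x ] (inj₁ (SameEdge-flip s))
    go (inj₂ q) = PathEdge-++⁺ˡ (reverse t) y [ x ]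
      (subst (λ Z → PathEdge Z u w) (Listₚ.unfold-reverse y t) (PathEdge-reverse (y ∷ t) q))

  PathEdge-reverse⁻ : ∀ L {u w} → PathEdge (reverse L) u w → PathEdge L u w
  PathEdge-reverse⁻ L {u} {w} p =
    subst (λ Z → PathEdge Z u w) (Listₚ.reverse-involutive L) (PathEdge-reverse (reverse L) p)

  PathEdge-head : ∀ x y t {u w} → Unique (x ∷ y ∷ t) → PathEdge (x ∷ y ∷ t) u w → u ≡ x → w ≡ y
  PathEdge-head x y t _ (inj₁ (inj₁ (refl , refl))) _ = refl
  PathEdge-head x y t u (inj₁ (inj₂ (refl , refl))) refl =
    ⊥-elim (Uniqueₚ.Unique[x∷xs]⇒x∉xs u (here refl))
  PathEdge-head x y t u (inj₂ p) refl =
    ⊥-elim (Uniqueₚ.Unique[x∷xs]⇒x∉xs u (proj₁ (PathEdge-∈ (y ∷ t) p)))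

  PathEdge-irrefl : ∀ L {u} → Unique L → ¬ PathEdge L u u
  PathEdge-irrefl (x ∷ y ∷ t) (x≢ ∷ _) (inj₁ (inj₁ (refl , refl))) = All.lookup x≢ (here refl) refl
  PathEdge-irrefl (x ∷ y ∷ t) (x≢ ∷ _) (inj₁ (inj₂ (refl , refl))) = All.lookup x≢ (here refl) refl
  PathEdge-irrefl (x ∷ y ∷ t) (_ ∷ u)  (inj₂ p)                     = PathEdge-irrefl (y ∷ t) u p

  PathEdge-chord : ∀ (a b : Fin n) M {u w} → Unique (a ∷ M ++ [ b ]) →
                   SameEdge u w a b → PathEdge (a ∷ M ++ [ b ]) u w → M ≡ []
  PathEdge-chord a b []      _  _ _ = refl
  PathEdge-chord a b (m ∷ M) ue s p = ⊥-elim (m∉ (∈ₚ.∈-++⁺ʳ M (here (sym (b≡m s)))))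
    where
    m∉ : m ∉ M ++ [ b ]
    m∉ = Uniqueₚ.Unique[x∷xs]⇒x∉xs (Uniqueₚ.drop⁺ 1 ue)
    b≡m : SameEdge _ _ a b → b ≡ m
    b≡m (inj₁ (refl , refl)) = PathEdge-head a m (M ++ [ b ]) ue p refl
    b≡m (inj₂ (refl , refl)) = PathEdge-head a m (M ++ [ b ]) ue (PathEdge-sym (a ∷ m ∷ M ++ [ b ]) p) refl

  arcs-common : ∀ (a b : Fin n) P Q {x} → Unique (a ∷ P ++ b ∷ Q) →
                x ∈ a ∷ P ++ [ b ] → x ∈ b ∷ Q ++ [ a ] → x ≡ a ⊎ x ≡ b
  arcs-common a b P Q u (here e) _ = inj₁ e
  arcs-common a b P Q u (there x∈) y∈ with ∈ₚ.∈-++⁻ P x∈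
  ... | inj₂ (here e) = inj₂ e
  ... | inj₁ x∈P with y∈
  ...   | here e = inj₂ e
  ...   | there y∈' with ∈ₚ.∈-++⁻ Q y∈'
  ...     | inj₂ (here e) = inj₁ e
  ...     | inj₁ x∈Q = ⊥-elim (proj₂ (proj₂ (Unique-++⁻ P (Uniqueₚ.drop⁺ 1 u))) (x∈P , there x∈Q))

  arcs-short : ∀ (a b : Fin n) P Q {u w} → Unique (a ∷ P ++ b ∷ Q) → 3 ≤ length (a ∷ P ++ b ∷ Q) →
               SameEdge u w a b → PathEdge (a ∷ P ++ [ b ]) u w → PathEdge (b ∷ Q ++ [ a ]) u w → ⊥
  arcs-short a b P Q u long s p q
    with PathEdge-chord a b P (proj₁ (Unique-arcs a P b Q u)) s p
       | PathEdge-chord b a Q (proj₂ (Unique-arcs a P b Q u)) (SameEdge-flip s) q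
  ... | refl | refl with long
  ... | s≤s (s≤s ())

  arcs-disjoint : ∀ (a b : Fin n) P Q {u w} → Unique (a ∷ P ++ b ∷ Q) → 3 ≤ length (a ∷ P ++ b ∷ Q) →
                  PathEdge (a ∷ P ++ [ b ]) u w → PathEdge (b ∷ Q ++ [ a ]) u w → ⊥
  arcs-disjoint a b P Q u long p q
    with arcs-common a b P Q u (proj₁ (PathEdge-∈ _ p)) (proj₁ (PathEdge-∈ _ q))
       | arcs-common a b P Q u (proj₂ (PathEdge-∈ _ p)) (proj₂ (PathEdge-∈ _ q))
  ... | inj₁ refl | inj₁ refl = PathEdge-irrefl _ (proj₁ (Unique-arcs a P b Q u)) p
  ... | inj₂ refl | inj₂ refl = PathEdge-irrefl _ (proj₁ (Unique-arcs a P b Q u)) p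
  ... | inj₁ refl | inj₂ refl = arcs-short a b P Q u long (inj₁ (refl , refl)) p q
  ... | inj₂ refl | inj₁ refl = arcs-short a b P Q u long (inj₂ (refl , refl)) p q

  PathEdge-inner : ∀ (a m : Fin n) M b {u w} → PathEdge (a ∷ m ∷ M ++ [ b ]) u w → u ∈ m ∷ M ⊎ w ∈ m ∷ M
  PathEdge-inner a m M b (inj₁ (inj₁ (_ , refl))) = inj₂ (here refl)
  PathEdge-inner a m M b (inj₁ (inj₂ (refl , _))) = inj₁ (here refl)
  PathEdge-inner a m M b (inj₂ p) = notLast m M p
    where
    notLast : ∀ m M {u w} → PathEdge (m ∷ M ++ [ b ]) u w → u ∈ m ∷ M ⊎ w ∈ m ∷ M
    notLast m []       (inj₁ (inj₁ (refl , _))) = inj₁ (here refl)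
    notLast m []       (inj₁ (inj₂ (_ , refl))) = inj₂ (here refl)
    notLast m (m' ∷ M) (inj₁ (inj₁ (refl , _))) = inj₁ (here refl)
    notLast m (m' ∷ M) (inj₁ (inj₂ (_ , refl))) = inj₂ (here refl)
    notLast m (m' ∷ M) (inj₂ p) with notLast m' M p
    ... | inj₁ q = inj₁ (there q)
    ... | inj₂ q = inj₂ (there q)

  PathEdge-first : ∀ (a : Fin n) M b → ∃ λ h → PathEdge (a ∷ M ++ [ b ]) a h
  PathEdge-first a []      b = b , inj₁ (inj₁ (refl , refl))
  PathEdge-first a (m ∷ M) b = m , inj₁ (inj₁ (refl , refl))

  PathEdge-segment : ∀ {L} P (a : Fin n) M b rest {u w} → L ≡ P ++ a ∷ M ++ b ∷ rest →
                     PathEdge (a ∷ M ++ [ b ]) u w → PathEdge L u w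
  PathEdge-segment P a M b rest {u} {w} refl p =
    PathEdge-++⁺ʳ P a (M ++ b ∷ rest) (PathEdge-++⁺ˡ (a ∷ M) b rest p)

  CycleEdge-arcs : ∀ a P b Q {u w} → CycleEdge (a ∷ P ++ b ∷ Q) u w →
                   PathEdge (a ∷ P ++ [ b ]) u w ⊎ PathEdge (b ∷ Q ++ [ a ]) u w
  CycleEdge-arcs a P b Q {u} {w} p = PathEdge-++⁻ (a ∷ P) b (Q ++ [ a ])
    (subst (λ Z → PathEdge (a ∷ Z) u w) (Listₚ.++-assoc P (b ∷ Q) [ a ]) p)

  CycleEdge-arcˡ : ∀ a P b Q {u w} → PathEdge (a ∷ P ++ [ b ]) u w → CycleEdge (a ∷ P ++ b ∷ Q) u w
  CycleEdge-arcˡ a P b Q {u} {w} p = subst (λ Z → PathEdge (a ∷ Z) u w) (sym (Listₚ.++-assoc P (b ∷ Q) [ a ]))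
    (PathEdge-++⁺ˡ (a ∷ P) b (Q ++ [ a ]) p)

  CycleEdge-arcʳ : ∀ a P b Q {u w} → PathEdge (b ∷ Q ++ [ a ]) u w → CycleEdge (a ∷ P ++ b ∷ Q) u w
  CycleEdge-arcʳ a P b Q {u} {w} p = subst (λ Z → PathEdge (a ∷ Z) u w) (sym (Listₚ.++-assoc P (b ∷ Q) [ a ]))
    (PathEdge-++⁺ʳ (a ∷ P) b (Q ++ [ a ]) p)

  CycleEdge-rotate : ∀ A B {u w} → CycleEdge (A ++ B) u w → CycleEdge (B ++ A) u w
  CycleEdge-rotate []      B       {u} {w} p = subst (λ Z → CycleEdge Z u w) (sym (Listₚ.++-identityʳ B)) p
  CycleEdge-rotate (a ∷ A) []      {u} {w} p = subst (λ Z → CycleEdge Z u w) (Listₚ.++-identityʳ (a ∷ A)) p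
  CycleEdge-rotate (a ∷ A) (b ∷ B) p with CycleEdge-arcs a A b B p
  ... | inj₁ q = CycleEdge-arcʳ b B a A q
  ... | inj₂ q = CycleEdge-arcˡ b B a A q

  CycleEdge-at : ∀ (L : List (Fin n)) {x} → x ∈ L → ∃ λ w → CycleEdge L x w
  CycleEdge-at (y ∷ t) (here refl) = PathEdge-at y t y (here refl)
  CycleEdge-at (y ∷ t) (there x∈)  = PathEdge-at y t y (there (∈ₚ.∈-++⁺ˡ x∈))

  last : Fin n → List (Fin n) → Fin n
  last x []      = x
  last x (y ∷ t) = last y t

  PathEdge-∷ʳ⁻ : ∀ x t z {u w} → PathEdge (x ∷ t ++ [ z ]) u w →
                 PathEdge (x ∷ t) u w ⊎ SameEdge u w (last x t) z
  PathEdge-∷ʳ⁻ x []      z (inj₁ s) = inj₂ s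
  PathEdge-∷ʳ⁻ x (y ∷ t) z (inj₁ s) = inj₁ (inj₁ s)
  PathEdge-∷ʳ⁻ x (y ∷ t) z (inj₂ p) with PathEdge-∷ʳ⁻ y t z p
  ... | inj₁ q = inj₁ (inj₂ q)
  ... | inj₂ s = inj₂ s

  PathEdge-∷ʳ⁺ˡ : ∀ x t z {u w} → PathEdge (x ∷ t) u w → PathEdge (x ∷ t ++ [ z ]) u w
  PathEdge-∷ʳ⁺ˡ x (y ∷ t) z (inj₁ s) = inj₁ s
  PathEdge-∷ʳ⁺ˡ x (y ∷ t) z (inj₂ p) = inj₂ (PathEdge-∷ʳ⁺ˡ y t z p)

  PathEdge-∷ʳ⁺ʳ : ∀ x t z {u w} → SameEdge u w (last x t) z → PathEdge (x ∷ t ++ [ z ]) u w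
  PathEdge-∷ʳ⁺ʳ x []      z s = inj₁ s
  PathEdge-∷ʳ⁺ʳ x (y ∷ t) z s = inj₂ (PathEdge-∷ʳ⁺ʳ y t z s)

  -- These bridge the list view used in the
  -- proof and the indexed view of Defs.
  tabulate-PathEdge⁻ : ∀ {k} (f : Fin (suc k) → Fin n) {u w} → PathEdge (tabulate f) u w →
                       ∃ λ i → ∃ λ j → (toℕ j ≡ suc (toℕ i)) × SameEdge u w (f i) (f j)
  tabulate-PathEdge⁻ {suc k} f (inj₁ s) = Fin.zero , Fin.suc Fin.zero , refl , s
  tabulate-PathEdge⁻ {suc k} f (inj₂ p) with tabulate-PathEdge⁻ (λ x → f (Fin.suc x)) p
  ... | i , j , e , s = Fin.suc i , Fin.suc j , cong suc e , s

  tabulate-PathEdge⁺ : ∀ {k} (f : Fin (suc k) → Fin n) i j {u w} → toℕ j ≡ suc (toℕ i) →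
                       SameEdge u w (f i) (f j) → PathEdge (tabulate f) u w
  tabulate-PathEdge⁺ {zero}  f Fin.zero    Fin.zero               () s
  tabulate-PathEdge⁺ {suc k} f Fin.zero    (Fin.suc Fin.zero)     e  s = inj₁ s
  tabulate-PathEdge⁺ {suc k} f (Fin.suc i) (Fin.suc j)            e  s =
    inj₂ (tabulate-PathEdge⁺ (λ x → f (Fin.suc x)) i j (ℕₚ.suc-injective e) s)

  last-tabulate : ∀ {k} (f : Fin (suc k) → Fin n) →
                  last (f Fin.zero) (tabulate (λ x → f (Fin.suc x))) ≡ f (fromℕ k)
  last-tabulate {zero}  f = refl
  last-tabulate {suc k} f = last-tabulate (λ x → f (Fin.suc x))

  tabulate-CycleEdge⁻ : ∀ {k} (f : Fin (suc k) → Fin n) {u w} → CycleEdge (tabulate f) u w →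
                        ∃ λ i → ∃ λ j → (toℕ j ≡ suc (toℕ i) % suc k) × SameEdge u w (f i) (f j)
  tabulate-CycleEdge⁻ {k} f p with PathEdge-∷ʳ⁻ (f Fin.zero) (tabulate (λ x → f (Fin.suc x))) (f Fin.zero) p
  ... | inj₁ q with tabulate-PathEdge⁻ f q
  ... | i , j , e , s = i , j , trans e (sym (m<n⇒m%n≡m (subst (_< suc k) e (Finₚ.toℕ<n j)))) , s
  tabulate-CycleEdge⁻ {k} f p | inj₂ s =
    fromℕ k , Fin.zero ,
    sym (trans (cong (λ z → suc z % suc k) (Finₚ.toℕ-fromℕ k)) (n%n≡0 (suc k))) ,
    subst (λ z → SameEdge _ _ z (f Fin.zero)) (last-tabulate f) s

  tabulate-CycleEdge⁺ : ∀ {k} (f : Fin (suc k) → Fin n) i j {u w} → toℕ j ≡ suc (toℕ i) % suc k →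
                        SameEdge u w (f i) (f j) → CycleEdge (tabulate f) u w
  tabulate-CycleEdge⁺ {k} f i j e s with ℕₚ.m≤n⇒m<n∨m≡n (Finₚ.toℕ≤pred[n] i)
  ... | inj₁ i<k = PathEdge-∷ʳ⁺ˡ (f Fin.zero) (tabulate (λ x → f (Fin.suc x))) (f Fin.zero)
                     (tabulate-PathEdge⁺ f i j (trans e (m<n⇒m%n≡m (s≤s i<k))) s)
  ... | inj₂ i≡k with Finₚ.toℕ-injective {i = i} {j = fromℕ k} (trans i≡k (sym (Finₚ.toℕ-fromℕ k)))
  ... | refl with Finₚ.toℕ-injective {i = j} {j = Fin.zero}
                   (trans e (trans (cong (λ z → suc z % suc k) i≡k) (n%n≡0 (suc k))))
  ... | refl = PathEdge-∷ʳ⁺ʳ (f Fin.zero) (tabulate (λ x → f (Fin.suc x))) (f Fin.zero)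
                 (subst (λ z → SameEdge _ _ z (f Fin.zero)) (sym (last-tabulate f)) s)

parity : ℕ → Bool
parity zero    = false
parity (suc k) = not (parity k)

parity-+ : ∀ m k → parity (m + k) ≡ parity m xor parity k
parity-+ zero    k = refl
parity-+ (suc m) k = trans (cong not (parity-+ m k)) (not-xor (parity m))
  where
  not-xor : ∀ a {b} → not (a xor b) ≡ not a xor b
  not-xor true  = not-involutive _
  not-xor false = refl

parity-odd : ∀ k → k % 2 ≡ 1 → parity k ≡ true
parity-odd (suc zero)    _ = refl
parity-odd (suc (suc k)) e = trans (not-involutive (parity k)) (parity-odd k e)

odd-parity : ∀ k → parity k ≡ true → k % 2 ≡ 1
odd-parity (suc zero)    _ = refl
odd-parity (suc (suc k)) e = odd-parity k (trans (sym (not-involutive (parity k))) e)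

length-cycle : ∀ {A : Set} (a : A) P b Q → length (a ∷ P ++ b ∷ Q) ≡ 2 + (length P + length Q)
length-cycle a P b Q = cong suc (trans (Listₚ.length-++ P) (ℕₚ.+-suc (length P) (length Q)))

parity-cycle : ∀ {A : Set} (a : A) P b Q →
               parity (length (a ∷ P ++ b ∷ Q)) ≡ parity (length P) xor parity (length Q)
parity-cycle a P b Q = begin
  parity (length (a ∷ P ++ b ∷ Q))         ≡⟨ cong parity (length-cycle a P b Q) ⟩
  not (not (parity (length P + length Q))) ≡⟨ not-involutive _ ⟩
  parity (length P + length Q)             ≡⟨ parity-+ (length P) (length Q) ⟩
  parity (length P) xor parity (length Q)  ∎
  where open ≡-Reasoning

long-cycle : ∀ {A : Set} (a : A) P b Q → parity (length P) xor parity (length Q) ≡ true →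
             3 ≤ length (a ∷ P ++ b ∷ Q)
long-cycle a P b Q odd = subst (3 ≤_) (sym (length-cycle a P b Q))
  (s≤s (s≤s (positive (length P + length Q) (trans (parity-+ (length P) (length Q)) odd))))
  where
  positive : ∀ k → parity k ≡ true → 1 ≤ k
  positive (suc k) _ = s≤s z≤n

xor-split : ∀ p q r → p xor q ≡ true → r xor p ≡ true ⊎ r xor q ≡ true
xor-split true  false false _ = inj₁ refl
xor-split true  false true  _ = inj₂ refl
xor-split false true  false _ = inj₂ refl
xor-split false true  true  _ = inj₁ refl

does-true : ∀ {P : Set} (P? : Dec P) → does P? ≡ true → P
does-true (yes p) _ = p

module _ {n : ℕ} where

  subgraphOf : {P : Fin n → Set} {R : Fin n → Fin n → Set} →
               (∀ x → Dec (P x)) → (∀ x y → Dec (R x y)) → Subgraph n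
  subgraphOf P? R? = mkSub (Vec.tabulate (λ x → does (P? x)))
                           (Vec.tabulate (λ x → Vec.tabulate (λ y → does (R? x y))))

  ∈-tabulate⇔ : ∀ {P : Fin n → Set} (P? : ∀ x → Dec (P x)) x → (x ∈ₛ Vec.tabulate (λ y → does (P? y))) ⇔ P x
  ∈-tabulate⇔ P? x = mk⇔
    (λ x∈ → does-true (P? x) (trans (sym (Vecₚ.lookup∘tabulate (λ y → does (P? y)) x)) (Vecₚ.[]=⇒lookup x∈)))
    (λ px → Vecₚ.lookup⇒[]= x _ (trans (Vecₚ.lookup∘tabulate (λ y → does (P? y)) x) (dec-true (P? x) px)))

  verts-subgraphOf : ∀ {P : Fin n → Set} {R : Fin n → Fin n → Set} (P? : ∀ x → Dec (P x)) (R? : ∀ x y → Dec (R x y)) x →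
                     (x ∈ₛ verts (subgraphOf P? R?)) ⇔ P x
  verts-subgraphOf P? R? = ∈-tabulate⇔ P?

  edges-subgraphOf : ∀ {P : Fin n → Set} {R : Fin n → Fin n → Set} (P? : ∀ x → Dec (P x)) (R? : ∀ x y → Dec (R x y)) x y →
                     ((x , y) ∈ₑ edges (subgraphOf P? R?)) ⇔ R x y
  edges-subgraphOf P? R? x y =
    subst (λ row → (y ∈ₛ row) ⇔ _) (sym (Vecₚ.lookup∘tabulate _ x)) (∈-tabulate⇔ (R? x) y)

  ∈⇔lookup : ∀ (L : List (Fin n)) x → (x ∈ L) ⇔ (∃ λ i → x ≡ lookup L i)
  ∈⇔lookup L x = mk⇔
    (λ x∈ → ∈ₚ.∈-tabulate⁻ (subst (x ∈_) (sym (Listₚ.tabulate-lookup L)) x∈))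
    (λ { (i , refl) → ∈ₚ.∈-lookup i })

  PathEdge⇔lookup : ∀ (x : Fin n) t u w → PathEdge (x ∷ t) u w ⇔
    (∃ λ i → ∃ λ j → (toℕ j ≡ suc (toℕ i)) × SameEdge u w (lookup (x ∷ t) i) (lookup (x ∷ t) j))
  PathEdge⇔lookup x t u w = mk⇔
    (λ p → tabulate-PathEdge⁻ (lookup (x ∷ t)) (subst (λ Z → PathEdge Z u w) (sym (Listₚ.tabulate-lookup (x ∷ t))) p))
    (λ { (i , j , e , s) → subst (λ Z → PathEdge Z u w) (Listₚ.tabulate-lookup (x ∷ t))
                             (tabulate-PathEdge⁺ (lookup (x ∷ t)) i j e s) })

  CycleEdge⇔lookup : ∀ (x : Fin n) t u w → CycleEdge (x ∷ t) u w ⇔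
    (∃ λ i → ∃ λ j → (toℕ j ≡ suc (toℕ i) % suc (length t)) × SameEdge u w (lookup (x ∷ t) i) (lookup (x ∷ t) j))
  CycleEdge⇔lookup x t u w = mk⇔
    (λ p → tabulate-CycleEdge⁻ (lookup (x ∷ t)) (subst (λ Z → CycleEdge Z u w) (sym (Listₚ.tabulate-lookup (x ∷ t))) p))
    (λ { (i , j , e , s) → subst (λ Z → CycleEdge Z u w) (Listₚ.tabulate-lookup (x ∷ t))
                             (tabulate-CycleEdge⁺ (lookup (x ∷ t)) i j e s) })

  isPath-traced : ∀ {H : Subgraph n} x t → Unique (x ∷ t) →
                  (∀ y → (y ∈ₛ verts H) ⇔ (y ∈ x ∷ t)) →
                  (∀ u w → ((u , w) ∈ₑ edges H) ⇔ PathEdge (x ∷ t) u w) → IsPath H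
  isPath-traced x t u V E =
    length t , lookup (x ∷ t) , lookup-injective (x ∷ t) u ,
    (λ y → ∈⇔lookup (x ∷ t) y ⇔-∘ V y) , (λ v w → PathEdge⇔lookup x t v w ⇔-∘ E v w)

  cycleTraced : List (Fin n) → Subgraph n
  cycleTraced L = subgraphOf (λ x → any? (x ≟_) L) (CycleEdge? L)

  edges-cycleTraced : ∀ L u w → ((u , w) ∈ₑ edges (cycleTraced L)) ⇔ CycleEdge L u w
  edges-cycleTraced L = edges-subgraphOf (λ x → any? (x ≟_) L) (CycleEdge? L)

  isOddCycle-traced : ∀ (G : Graph n) L → Unique L → 3 ≤ length L → parity (length L) ≡ true →
                      (∀ {u w} → CycleEdge L u w → Adj G u w) → IsOddCycle G (cycleTraced L)
  isOddCycle-traced G (x ∷ [])         _ (s≤s ())             _ _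
  isOddCycle-traced G (x ∷ y ∷ [])     _ (s≤s (s≤s ()))       _ _
  isOddCycle-traced G (x ∷ y ∷ z ∷ t) u _ odd adj =
    length t , (lookup L , (lookup-injective L u , V , E) , A) , odd-parity (length L) odd
    where
    L = x ∷ y ∷ z ∷ t
    V : ∀ v → (v ∈ₛ verts (cycleTraced L)) ⇔ (∃ λ i → v ≡ lookup L i)
    V v = ∈⇔lookup L v ⇔-∘ verts-subgraphOf (λ x → any? (x ≟_) L) (CycleEdge? L) v
    E : ∀ v w → ((v , w) ∈ₑ edges (cycleTraced L)) ⇔
          (∃ λ i → ∃ λ j → (toℕ j ≡ suc (toℕ i) % (3 + length t)) × SameEdge v w (lookup L i) (lookup L j))
    E v w = CycleEdge⇔lookup x (y ∷ z ∷ t) v w ⇔-∘ edges-cycleTraced L v w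
    A : ∀ i j → toℕ j ≡ suc (toℕ i) % (3 + length t) → Adj G (lookup L i) (lookup L j)
    A i j e = adj (Equivalence.from (CycleEdge⇔lookup x (y ∷ z ∷ t) _ _) (i , j , e , inj₁ (refl , refl)))

record OddCycleWalk {n} (G : Graph n) (K : Subgraph n) : Set where
  field
    walk     : List (Fin n)
    unique   : Unique walk
    long     : 3 ≤ length walk
    odd      : parity (length walk) ≡ true
    vertex⁺  : ∀ {x} → x ∈ₛ verts K → x ∈ walk
    vertex⁻  : ∀ {x} → x ∈ walk → x ∈ₛ verts K
    edge⁺    : ∀ {u w} → (u , w) ∈ₑ edges K → CycleEdge walk u w
    edge⁻    : ∀ {u w} → CycleEdge walk u w → (u , w) ∈ₑ edges K
    adjacent : ∀ {u w} → CycleEdge walk u w → Adj G u w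

module _ {n} {G : Graph n} where

  oddCycleWalk : ∀ {K} → IsOddCycle G K → OddCycleWalk G K
  oddCycleWalk {K} (m , (v , (inj , V , E) , adj) , odd) = record
    { walk     = tabulate v
    ; unique   = Uniqueₚ.tabulate⁺ inj
    ; long     = subst (3 ≤_) (sym (Listₚ.length-tabulate v)) (s≤s (s≤s (s≤s z≤n)))
    ; odd      = subst (λ k → parity k ≡ true) (sym (Listₚ.length-tabulate v)) (parity-odd (3 + m) odd)
    ; vertex⁺  = λ x∈ → let (i , e) = Equivalence.to (V _) x∈ in subst (_∈ tabulate v) (sym e) (∈ₚ.∈-tabulate⁺ {f = v} i)
    ; vertex⁻  = λ x∈ → Equivalence.from (V _) (∈ₚ.∈-tabulate⁻ x∈)
    ; edge⁺    = λ e∈ → let (i , j , e , s) = Equivalence.to (E _ _) e∈ in tabulate-CycleEdge⁺ v i j e s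
    ; edge⁻    = λ p → Equivalence.from (E _ _) (tabulate-CycleEdge⁻ v p)
    ; adjacent = λ p → let (i , j , e , s) = tabulate-CycleEdge⁻ v p in adjSameEdge (adj i j e) s
    }
    where
    adjSameEdge : ∀ {a b u w} → Adj G a b → SameEdge u w a b → Adj G u w
    adjSameEdge a (inj₁ (refl , refl)) = a
    adjSameEdge a (inj₂ (refl , refl)) = Graph.sym G a

  rotate : ∀ {K} (c : OddCycleWalk G K) A B → OddCycleWalk.walk c ≡ A ++ B → OddCycleWalk G K
  rotate c A B eq = record
    { walk     = B ++ A
    ; unique   = Unique-rotate A B (subst Unique eq unique)
    ; long     = subst (3 ≤_) same-length long
    ; odd      = subst (λ k → parity k ≡ true) same-length odd
    ; vertex⁺  = λ x∈ → ∈-resp-↭ (++-comm A B) (subst (_ ∈_) eq (vertex⁺ x∈))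
    ; vertex⁻  = λ x∈ → vertex⁻ (subst (_ ∈_) (sym eq) (∈-resp-↭ (++-comm B A) x∈))
    ; edge⁺    = λ e∈ → CycleEdge-rotate A B (subst (λ Z → CycleEdge Z _ _) eq (edge⁺ e∈))
    ; edge⁻    = λ p → edge⁻ (subst (λ Z → CycleEdge Z _ _) (sym eq) (CycleEdge-rotate B A p))
    ; adjacent = λ p → adjacent (subst (λ Z → CycleEdge Z _ _) (sym eq) (CycleEdge-rotate B A p))
    }
    where
    open OddCycleWalk c
    same-length : length walk ≡ length (B ++ A)
    same-length = trans (cong length eq) (trans (Listₚ.length-++ A)
                    (trans (ℕₚ.+-comm (length A) (length B)) (sym (Listₚ.length-++ B))))

  startingAt : ∀ {K x} (c : OddCycleWalk G K) → x ∈ OddCycleWalk.walk c →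
               Σ (OddCycleWalk G K) λ c' → ∃ λ t → OddCycleWalk.walk c' ≡ x ∷ t
  startingAt {x = x} c x∈ with ∈ₚ.∈-∃++ x∈
  ... | P , S , eq = rotate c P (x ∷ S) eq , S ++ P , refl

module _ {n} {H K : Subgraph n} where

  ∩ᵍ-verts : ∀ {x} → (x ∈ₛ verts (H ∩ᵍ K)) ⇔ (x ∈ₛ verts H × x ∈ₛ verts K)
  ∩ᵍ-verts = mk⇔ (Subsetₚ.x∈p∩q⁻ (verts H) (verts K)) Subsetₚ.x∈p∩q⁺

  ∩ᵍ-edges : ∀ {u w} → ((u , w) ∈ₑ edges (H ∩ᵍ K)) ⇔ ((u , w) ∈ₑ edges H × (u , w) ∈ₑ edges K)
  ∩ᵍ-edges {u} {w} = mk⇔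
    (λ uw → Subsetₚ.x∈p∩q⁻ _ _ (subst (w ∈ₛ_) (Vecₚ.lookup-zipWith _∩_ u (edges H) (edges K)) uw))
    (λ uw → subst (w ∈ₛ_) (sym (Vecₚ.lookup-zipWith _∩_ u (edges H) (edges K))) (Subsetₚ.x∈p∩q⁺ uw))

  -- Intersection is commutative, so `meet` may be applied in either order.
  ∩ᵍ-comm : H ∩ᵍ K ≡ K ∩ᵍ H
  ∩ᵍ-comm = cong₂ mkSub (Subsetₚ.∩-comm (verts H) (verts K)) (Vecₚ.zipWith-comm Subsetₚ.∩-comm (edges H) (edges K))

module AroundCycle {n} (G : Graph n) {C : Subgraph n} (c : OddCycleWalk G C) where

  module Cw = OddCycleWalk c

  OnC : Fin n → Set
  OnC x = x ∈ₛ verts C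

  OffC : Fin n → Set
  OffC x = ¬ OnC x

  CEdge : Fin n → Fin n → Set
  CEdge u w = (u , w) ∈ₑ edges C

  CEdge? : ∀ u w → Dec (CEdge u w)
  CEdge? u w = w Subsetₚ.∈? Vec.lookup (edges C) u

  CEdge-sym : ∀ {u w} → CEdge u w → CEdge w u
  CEdge-sym uw = Cw.edge⁻ (CycleEdge-sym Cw.walk (Cw.edge⁺ uw))
    where
    CycleEdge-sym : ∀ L {u w} → CycleEdge L u w → CycleEdge L w u
    CycleEdge-sym (x ∷ t) = PathEdge-sym (x ∷ t ++ [ x ])

  CEdge-ends : ∀ {u w} → CEdge u w → OnC u × OnC w
  CEdge-ends uw with CycleEdge-∈ Cw.walk (Cw.edge⁺ uw)
  ... | u∈ , w∈ = Cw.vertex⁻ u∈ , Cw.vertex⁻ w∈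

  CEdge-SameEdge : ∀ {a b u w} → CEdge a b → SameEdge u w a b → CEdge u w
  CEdge-SameEdge ab (inj₁ (refl , refl)) = ab
  CEdge-SameEdge ab (inj₂ (refl , refl)) = CEdge-sym ab

  Departure : List (Fin n) → Set
  Departure L = ∃ λ P → ∃ λ a → ∃ λ c → ∃ λ r → (L ≡ P ++ a ∷ c ∷ r) × OnC a × ¬ CEdge a c

  scan : ∀ a r → OnC a → (∀ {u w} → PathEdge (a ∷ r) u w → CEdge u w) ⊎ Departure (a ∷ r)
  scan a []      _   = inj₁ λ ()
  scan a (b ∷ r) a∈ with CEdge? a b
  ... | no ¬ab = inj₂ ([] , a , b , r , refl , a∈ , ¬ab)
  ... | yes ab with scan b r (proj₂ (CEdge-ends ab))
  ...   | inj₁ along = inj₁ λ { (inj₁ s) → CEdge-SameEdge ab s ; (inj₂ p) → along p }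
  ...   | inj₂ (P , a' , c' , r' , eq , a'∈ , ¬a'c') = inj₂ (a ∷ P , a' , c' , r' , cong (a ∷_) eq , a'∈ , ¬a'c')

  firstReturn : ∀ t z → OnC z → ∃ λ mid → ∃ λ b → ∃ λ rest →
                (t ++ [ z ] ≡ mid ++ b ∷ rest) × All OffC mid × OnC b
  firstReturn []      z z∈ = [] , z , [] , refl , [] , z∈
  firstReturn (x ∷ t) z z∈ with x Subsetₚ.∈? verts C
  ... | yes x∈ = [] , x , t ++ [ z ] , refl , [] , x∈
  ... | no x∉ with firstReturn t z z∈
  ...   | mid , b , rest , eq , off , b∈ = x ∷ mid , b , rest , cong (x ∷_) eq , x∉ ∷ off , b∈

  returnAfter : ∀ a t z {c r} → OnC z → t ++ [ z ] ≡ c ∷ r → ¬ CEdge a c →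
                ∃ λ mid → ∃ λ b → ∃ λ rest → (t ++ [ z ] ≡ mid ++ b ∷ rest) ×
                  All OffC mid × OnC b × (mid ≡ [] → ¬ CEdge a b)
  returnAfter a t z z∈ eq ¬ac with firstReturn t z z∈
  ... | mid , b , rest , eq' , off , b∈ = mid , b , rest , eq' , off , b∈ , notChord
    where
    notChord : mid ≡ [] → ¬ CEdge a b
    notChord refl with Listₚ.∷-injective (trans (sym eq) eq')
    ... | refl , _ = ¬ac

  record Ear (a : Fin n) (mid : List (Fin n)) (b : Fin n) : Set where
    field
      startOnC : OnC a
      endOnC   : OnC b
      offC     : All OffC mid
      notChord : mid ≡ [] → ¬ CEdge a b
      unique   : Unique (a ∷ mid ++ [ b ])
      alongG   : ∀ {u w} → PathEdge (a ∷ mid ++ [ b ]) u w → Adj G u w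

  Ear-offC : ∀ {a mid b} → Ear a mid b → ∀ {u w} → PathEdge (a ∷ mid ++ [ b ]) u w → ¬ CEdge u w
  Ear-offC {a} {[]}    {b} e (inj₁ s) uw = Ear.notChord e refl (CEdge-SameEdge uw (SameEdge-swap s))
  Ear-offC {a} {m ∷ M} {b} e p uw with PathEdge-inner a m M b p | CEdge-ends uw
  ... | inj₁ u∈ | u∈C , _ = All.lookup (Ear.offC e) u∈ u∈C
  ... | inj₂ w∈ | _ , w∈C = All.lookup (Ear.offC e) w∈ w∈C

  record Arc (b a : Fin n) : Set where
    field
      inner  : List (Fin n)
      unique : Unique (b ∷ inner ++ [ a ])
      onC    : ∀ {x} → x ∈ b ∷ inner → OnC x
      alongC : ∀ {u w} → PathEdge (b ∷ inner ++ [ a ]) u w → CEdge u w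

  -- Two distinct vertices a, b of C split C into two arcs from b to a,
  -- whose lengths have different parities because C is odd.
  twoArcs : ∀ {a b} → OnC a → OnC b → a ≢ b → Σ (Arc b a) λ X → Σ (Arc b a) λ Y →
            parity (length (Arc.inner X)) xor parity (length (Arc.inner Y)) ≡ true
  twoArcs {a} {b} a∈ b∈ a≢b with startingAt c (Cw.vertex⁺ a∈)
  ... | c' , t , walk≡ with subst (b ∈_) walk≡ (OddCycleWalk.vertex⁺ c' b∈)
  ...   | here b≡a = ⊥-elim (a≢b (sym b≡a))
  ...   | there b∈t with ∈ₚ.∈-∃++ b∈t
  ...     | A , B , refl = reversedA , arcB , parities
    where
    module C' = OddCycleWalk c'
    onC : ∀ {x} → x ∈ a ∷ A ++ b ∷ B → OnC x
    onC x∈ = C'.vertex⁻ (subst (_ ∈_) (sym walk≡) x∈)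
    alongC : ∀ {u w} → CycleEdge (a ∷ A ++ b ∷ B) u w → CEdge u w
    alongC p = C'.edge⁻ (subst (λ Z → CycleEdge Z _ _) (sym walk≡) p)
    arcs-unique = Unique-arcs a A b B (subst Unique walk≡ C'.unique)
    reverse-arc : reverse (a ∷ A ++ [ b ]) ≡ b ∷ reverse A ++ [ a ]
    reverse-arc = trans (Listₚ.unfold-reverse a (A ++ [ b ])) (cong (_++ [ a ]) (Listₚ.reverse-++ A [ b ]))
    arcB : Arc b a
    arcB = record
      { inner  = B
      ; unique = proj₂ arcs-unique
      ; onC    = λ x∈ → onC (there (∈ₚ.∈-++⁺ʳ A x∈))
      ; alongC = λ p → alongC (CycleEdge-arcʳ a A b B p)
      }
    reversedA : Arc b a
    reversedA = record
      { inner  = reverse A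
      ; unique = subst Unique reverse-arc (Unique-reverse _ (proj₁ arcs-unique))
      ; onC    = λ { (here refl) → b∈ ; (there x∈) → onC (there (∈ₚ.∈-++⁺ˡ (∈-resp-↭ (↭-reverse A) x∈))) }
      ; alongC = λ p → alongC (CycleEdge-arcˡ a A b B
                   (PathEdge-reverse⁻ (a ∷ A ++ [ b ]) (subst (λ Z → PathEdge Z _ _) (sym reverse-arc) p)))
      }
    parities : parity (length (reverse A)) xor parity (length B) ≡ true
    parities = begin
      parity (length (reverse A)) xor parity (length B) ≡⟨ cong (λ k → parity k xor parity (length B)) (Listₚ.length-reverse A) ⟩
      parity (length A) xor parity (length B)           ≡⟨ sym (parity-cycle a A b B) ⟩
      parity (length (a ∷ A ++ b ∷ B))                  ≡⟨ subst (λ Z → parity (length Z) ≡ true) walk≡ C'.odd ⟩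
      true                                              ∎
      where open ≡-Reasoning

  EarCycle : Fin n → List (Fin n) → Fin n → Set
  EarCycle a mid b = Σ (Subgraph n) λ K → IsOddCycle G K ×
    (∀ {u w} → PathEdge (a ∷ mid ++ [ b ]) u w → (u , w) ∈ₑ edges K) ×
    (∀ {u w} → (u , w) ∈ₑ edges K → CEdge u w ⊎ PathEdge (a ∷ mid ++ [ b ]) u w)

  closeEar : ∀ {a mid b} → Ear a mid b → (X : Arc b a) →
             parity (length mid) xor parity (length (Arc.inner X)) ≡ true → EarCycle a mid b
  closeEar {a} {mid} {b} e X odd =
    cycleTraced L ,
    isOddCycle-traced G L uniqueL (long-cycle a mid b (Arc.inner X) odd) oddL adjL ,
    (λ p → Equivalence.from (edges-cycleTraced L _ _) (CycleEdge-arcˡ a mid b (Arc.inner X) p)) ,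
    (λ uw → map₁ (Arc.alongC X) (swap (CycleEdge-arcs a mid b (Arc.inner X) (Equivalence.to (edges-cycleTraced L _ _) uw))))
    where
    L = a ∷ mid ++ b ∷ Arc.inner X
    ear = Unique-++⁻ (a ∷ mid) (Ear.unique e)
    arc = Unique-++⁻ (b ∷ Arc.inner X) (Arc.unique X)
    disjoint : Disjoint (a ∷ mid) (b ∷ Arc.inner X)
    disjoint (here refl , a∈) = proj₂ (proj₂ arc) (a∈ , here refl)
    disjoint (there v∈ , v∈') = All.lookup (Ear.offC e) v∈ (Arc.onC X v∈')
    uniqueL : Unique L
    uniqueL = Uniqueₚ.++⁺ (proj₁ ear) (proj₁ arc) disjoint
    oddL : parity (length L) ≡ true
    oddL = trans (parity-cycle a mid b (Arc.inner X)) odd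
    adjL : ∀ {u w} → CycleEdge L u w → Adj G u w
    adjL p with CycleEdge-arcs a mid b (Arc.inner X) p
    ... | inj₁ q = Ear.alongG e q
    ... | inj₂ q = Cw.adjacent (Cw.edge⁺ (Arc.alongC X q))

  earCycle : ∀ {a mid b} → Ear a mid b → EarCycle a mid b
  earCycle {a} {mid} {b} e with twoArcs (Ear.startOnC e) (Ear.endOnC e) a≢b
    where
    a≢b : a ≢ b
    a≢b refl = Uniqueₚ.Unique[x∷xs]⇒x∉xs (Ear.unique e) (∈ₚ.∈-++⁺ʳ mid (here refl))
  ... | X , Y , XY with xor-split _ _ (parity (length mid)) XY
  ...   | inj₁ odd = closeEar e X odd
  ...   | inj₂ odd = closeEar e Y odd

  TwoMore : Subgraph n → Set
  TwoMore D = Σ (Subgraph n) λ K₁ → Σ (Subgraph n) λ K₂ → IsOddCycle G K₁ × IsOddCycle G K₂ ×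
              K₁ ≢ K₂ × K₁ ≢ C × K₂ ≢ C × K₁ ≢ D × K₂ ≢ D

  separates : ∀ {K K' : Subgraph n} {u w} → (u , w) ∈ₑ edges K → ¬ (u , w) ∈ₑ edges K' → K ≢ K'
  separates uw ¬uw refl = ¬uw uw

  module _ {D : Subgraph n} (d : OddCycleWalk G D) where

    module Dw = OddCycleWalk d

    C∩D-verts : ∀ {x} → (x ∈ₛ verts (C ∩ᵍ D)) ⇔ (OnC x × x ∈ₛ verts D)
    C∩D-verts = ∩ᵍ-verts {H = C} {K = D}

    C∩D-edges : ∀ {u w} → ((u , w) ∈ₑ edges (C ∩ᵍ D)) ⇔ (CEdge u w × (u , w) ∈ₑ edges D)
    C∩D-edges = ∩ᵍ-edges {H = C} {K = D}

    singleVertex : ∀ a t → Dw.walk ≡ a ∷ t → OnC a → All OffC t → IsPath (C ∩ᵍ D)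
    singleVertex a t walk≡ a∈ off = isPath-traced {H = C ∩ᵍ D} a [] ([] ∷ []) V E
      where
      onlyA : ∀ {x} → x ∈ₛ verts (C ∩ᵍ D) → x ≡ a
      onlyA x∈ with Equivalence.to C∩D-verts x∈
      ... | x∈C , x∈D with subst (_ ∈_) walk≡ (Dw.vertex⁺ x∈D)
      ...   | here x≡a  = x≡a
      ...   | there x∈t = ⊥-elim (All.lookup off x∈t x∈C)
      V : ∀ y → (y ∈ₛ verts (C ∩ᵍ D)) ⇔ (y ∈ a ∷ [])
      V y = mk⇔ (λ y∈ → here (onlyA y∈))
                (λ { (here refl) → Equivalence.from C∩D-verts (a∈ , Dw.vertex⁻ (subst (_ ∈_) (sym walk≡) (here refl))) })
      noEdge : ∀ {u w} → (u , w) ∈ₑ edges (C ∩ᵍ D) → ⊥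
      noEdge {u} {w} uw with Equivalence.to C∩D-edges uw
      ... | uwC , uwD with CEdge-ends uwC | CycleEdge-∈ Dw.walk (Dw.edge⁺ uwD)
      ...   | u∈C , w∈C | u∈D , w∈D with onlyA (Equivalence.from C∩D-verts (u∈C , Dw.vertex⁻ u∈D))
                                      | onlyA (Equivalence.from C∩D-verts (w∈C , Dw.vertex⁻ w∈D))
      ...     | refl | refl = Graph.irrefl G (Cw.adjacent (Cw.edge⁺ uwC))
      E : ∀ u w → ((u , w) ∈ₑ edges (C ∩ᵍ D)) ⇔ PathEdge (a ∷ []) u w
      E u w = mk⇔ (λ uw → ⊥-elim (noEdge uw)) λ ()

    earOf : ∀ a mid b s → Dw.walk ≡ a ∷ mid ++ b ∷ s → OnC a → OnC b → All OffC mid →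
            (mid ≡ [] → ¬ CEdge a b) → Ear a mid b
    earOf a mid b s walk≡ a∈ b∈ off notChord = record
      { startOnC = a∈ ; endOnC = b∈ ; offC = off ; notChord = notChord
      ; unique   = proj₁ (Unique-arcs a mid b s (subst Unique walk≡ Dw.unique))
      ; alongG   = λ p → Dw.adjacent (subst (λ Z → CycleEdge Z _ _) (sym walk≡) (CycleEdge-arcˡ a mid b s p))
      }

    returnPath : ∀ a mid b s → Dw.walk ≡ a ∷ mid ++ b ∷ s → Ear a mid b →
                 (∀ {u w} → PathEdge (b ∷ s ++ [ a ]) u w → CEdge u w) → IsPath (C ∩ᵍ D)
    returnPath a mid b s walk≡ e along =
      isPath-traced {H = C ∩ᵍ D} b (s ++ [ a ]) (proj₂ (Unique-arcs a mid b s (subst Unique walk≡ Dw.unique))) V E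
      where
      inD : ∀ {x} → x ∈ b ∷ s ++ [ a ] → x ∈ₛ verts D
      inD x∈ = Dw.vertex⁻ (subst (_ ∈_) (sym walk≡) (∈-arcʳ⁺ a mid b s x∈))
      inC : ∀ {x} → x ∈ b ∷ s ++ [ a ] → OnC x
      inC x∈ with PathEdge-at b s a x∈
      ... | w , p = proj₁ (CEdge-ends (along p))
      V : ∀ y → (y ∈ₛ verts (C ∩ᵍ D)) ⇔ (y ∈ b ∷ s ++ [ a ])
      V y = mk⇔ to (λ y∈ → Equivalence.from C∩D-verts (inC y∈ , inD y∈))
        where
        to : y ∈ₛ verts (C ∩ᵍ D) → y ∈ b ∷ s ++ [ a ]
        to y∈ with Equivalence.to C∩D-verts y∈
        ... | y∈C , y∈D with ∈-arcs⁻ a mid b s (subst (_ ∈_) walk≡ (Dw.vertex⁺ y∈D))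
        ...   | inj₁ y∈mid = ⊥-elim (All.lookup (Ear.offC e) y∈mid y∈C)
        ...   | inj₂ y∈R   = y∈R
      E : ∀ u w → ((u , w) ∈ₑ edges (C ∩ᵍ D)) ⇔ PathEdge (b ∷ s ++ [ a ]) u w
      E u w = mk⇔ to (λ p → Equivalence.from C∩D-edges
                        (along p , Dw.edge⁻ (subst (λ Z → CycleEdge Z _ _) (sym walk≡) (CycleEdge-arcʳ a mid b s p))))
        where
        to : (u , w) ∈ₑ edges (C ∩ᵍ D) → PathEdge (b ∷ s ++ [ a ]) u w
        to uw with Equivalence.to C∩D-edges uw
        ... | uwC , uwD with CycleEdge-arcs a mid b s (subst (λ Z → CycleEdge Z _ _) walk≡ (Dw.edge⁺ uwD))
        ...   | inj₁ p = ⊥-elim (Ear-offC e p uwC)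
        ...   | inj₂ p = p

    -- They are told
    -- apart from each other and from C, D by the first edges of the ears,
    -- using that the ear and R share no edge.
    twoEars : ∀ a mid b s P a₂ mid₂ b₂ rest → Dw.walk ≡ a ∷ mid ++ b ∷ s →
              b ∷ s ++ [ a ] ≡ P ++ a₂ ∷ mid₂ ++ b₂ ∷ rest → Ear a mid b → Ear a₂ mid₂ b₂ → TwoMore D
    twoEars a mid b s P a₂ mid₂ b₂ rest walk≡ R≡ e₁ e₂ with earCycle e₁ | earCycle e₂
    ... | K₁ , odd₁ , in₁ , out₁ | K₂ , odd₂ , in₂ , out₂ =
      K₁ , K₂ , odd₁ , odd₂ , K₁≢K₂ , separates (in₁ first₁) off₁ , separates (in₂ first₂) off₂ ,
      (λ eq → separates (onD (inj₂ (E₂⊆R first₂))) notIn₁ (sym eq)) ,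
      (λ eq → separates (onD (inj₁ first₁)) notIn₂ (sym eq))
      where
      E₂⊆R : ∀ {u w} → PathEdge (a₂ ∷ mid₂ ++ [ b₂ ]) u w → PathEdge (b ∷ s ++ [ a ]) u w
      E₂⊆R = PathEdge-segment P a₂ mid₂ b₂ rest R≡
      onD : ∀ {u w} → PathEdge (a ∷ mid ++ [ b ]) u w ⊎ PathEdge (b ∷ s ++ [ a ]) u w → (u , w) ∈ₑ edges D
      onD p = Dw.edge⁻ (subst (λ Z → CycleEdge Z _ _) (sym walk≡)
                ([ CycleEdge-arcˡ a mid b s , CycleEdge-arcʳ a mid b s ]′ p))
      apart : ∀ {u w} → PathEdge (a ∷ mid ++ [ b ]) u w → ¬ PathEdge (b ∷ s ++ [ a ]) u w
      apart = arcs-disjoint a b mid s (subst Unique walk≡ Dw.unique) (subst (λ Z → 3 ≤ length Z) walk≡ Dw.long)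
      first₁ = proj₂ (PathEdge-first a mid b)
      first₂ = proj₂ (PathEdge-first a₂ mid₂ b₂)
      off₁ = Ear-offC e₁ first₁
      off₂ = Ear-offC e₂ first₂
      notIn₂ : ¬ (a , proj₁ (PathEdge-first a mid b)) ∈ₑ edges K₂
      notIn₂ uw = [ off₁ , (λ p → apart first₁ (E₂⊆R p)) ]′ (out₂ uw)
      notIn₁ : ¬ (a₂ , proj₁ (PathEdge-first a₂ mid₂ b₂)) ∈ₑ edges K₁
      notIn₁ uw = [ off₂ , (λ p → apart p (E₂⊆R first₂)) ]′ (out₁ uw)
      K₁≢K₂ : K₁ ≢ K₂
      K₁≢K₂ = separates (in₁ first₁) notIn₂

    afterEar : ∀ a mid b s → Dw.walk ≡ a ∷ mid ++ b ∷ s → Ear a mid b → IsPath (C ∩ᵍ D) ⊎ TwoMore D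
    afterEar a mid b s walk≡ e with scan b (s ++ [ a ]) (Ear.endOnC e)
    ... | inj₁ along = inj₁ (returnPath a mid b s walk≡ e along)
    ... | inj₂ (P , a₂ , c₂ , r₂ , R≡ , a₂∈ , ¬a₂c₂) with split-∷ʳ (b ∷ s) a P a₂ c₂ r₂ R≡
    ... | s₂ , bs≡ , c₂r₂≡ with returnAfter a₂ s₂ a (Ear.startOnC e) (sym c₂r₂≡) ¬a₂c₂
    ... | mid₂ , b₂ , rest , s₂≡ , off₂ , b₂∈ , notChord₂ = inj₂ (twoEars a mid b s P a₂ mid₂ b₂ rest walk≡ R≡₂ e e₂)
      where
      open ≡-Reasoning
      R≡₂ : b ∷ s ++ [ a ] ≡ P ++ a₂ ∷ mid₂ ++ b₂ ∷ rest
      R≡₂ = begin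
        (b ∷ s) ++ [ a ]          ≡⟨ cong (_++ [ a ]) bs≡ ⟩
        (P ++ a₂ ∷ s₂) ++ [ a ]   ≡⟨ Listₚ.++-assoc P (a₂ ∷ s₂) [ a ] ⟩
        P ++ a₂ ∷ s₂ ++ [ a ]     ≡⟨ cong (λ Z → P ++ a₂ ∷ Z) s₂≡ ⟩
        P ++ a₂ ∷ mid₂ ++ b₂ ∷ rest ∎
      uniqueR : Unique (b ∷ s ++ [ a ])
      uniqueR = proj₂ (Unique-arcs a mid b s (subst Unique walk≡ Dw.unique))
      e₂ : Ear a₂ mid₂ b₂
      e₂ = record
        { startOnC = a₂∈ ; endOnC = b₂∈ ; offC = off₂ ; notChord = notChord₂
        ; unique   = proj₁ (Unique-arcs a₂ mid₂ b₂ rest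
                       (proj₁ (proj₂ (Unique-++⁻ P (subst Unique R≡₂ uniqueR)))))
        ; alongG   = λ p → Dw.adjacent (subst (λ Z → CycleEdge Z _ _) (sym walk≡)
                       (CycleEdge-arcʳ a mid b s (PathEdge-segment P a₂ mid₂ b₂ rest R≡₂ p)))
        }

    fromDeparture : ∀ a t {c r} → Dw.walk ≡ a ∷ t → OnC a → t ++ [ a ] ≡ c ∷ r → ¬ CEdge a c →
                    IsPath (C ∩ᵍ D) ⊎ TwoMore D
    fromDeparture a t walk≡ a∈ next ¬ac with returnAfter a t a a∈ next ¬ac
    ... | mid , b , [] , t≡ , off , _ , _ =
      inj₁ (singleVertex a t walk≡ a∈ (subst (All OffC) (sym (proj₁ (Listₚ.∷ʳ-injective t mid t≡))) off))
    ... | mid , b , r₀ ∷ rest , t≡ , off , b∈ , notChord with split-∷ʳ t a mid b r₀ rest t≡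
    ... | s , t≡' , _ = afterEar a mid b s walk≡' (earOf a mid b s walk≡' a∈ b∈ off notChord)
      where
      walk≡' : Dw.walk ≡ a ∷ mid ++ b ∷ s
      walk≡' = trans walk≡ (cong (a ∷_) t≡')

    disjointWalk : ¬ Any OnC Dw.walk → IsEmpty (C ∩ᵍ D)
    disjointWalk none =
      (λ x x∈ → let x∈C , x∈D = Equivalence.to C∩D-verts x∈ in none (lose (Dw.vertex⁺ x∈D) x∈C)) ,
      (λ u w uw → let uwC , uwD = Equivalence.to C∩D-edges uw in
                  none (lose (proj₁ (CycleEdge-∈ Dw.walk (Dw.edge⁺ uwD))) (proj₁ (CEdge-ends uwC))))

  Outcome : Subgraph n → Set
  Outcome D = IsEmpty (C ∩ᵍ D) ⊎ IsPath (C ∩ᵍ D) ⊎ TwoMore D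

  -- Walk along D from
  -- a vertex of C to its first departure from C, and start there.
  meet : ∀ {D} (d : OddCycleWalk G D) → Outcome D ⊎ (∀ {u w} → (u , w) ∈ₑ edges D → CEdge u w)
  meet d with any? (λ x → x Subsetₚ.∈? verts C) (OddCycleWalk.walk d)
  ... | no none = inj₁ (inj₁ (disjointWalk d none))
  ... | yes some with find some
  ... | x , x∈ , x∈C with startingAt d x∈
  ... | d' , t , walk≡ with scan x (t ++ [ x ]) x∈C
  ... | inj₁ along = inj₂ (λ uw → along (subst (λ Z → CycleEdge Z _ _) walk≡ (OddCycleWalk.edge⁺ d' uw)))
  ... | inj₂ (P , a , c₁ , r , eq , a∈ , ¬ac) with rotate-to-step x t P a c₁ r eq
  ... | Q , S , x∷t≡ , r' , next =
    inj₁ (inj₂ (fromDeparture (rotate d' Q (a ∷ S) (trans walk≡ x∷t≡)) a (S ++ Q) refl a∈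
                  (trans (Listₚ.++-assoc S Q [ a ]) next) ¬ac))

noThreeAmongTwo : ∀ {A : Set} {p q a b c : A} → a ≡ p ⊎ a ≡ q → b ≡ p ⊎ b ≡ q → c ≡ p ⊎ c ≡ q →
                  a ≢ b → a ≢ c → b ≢ c → ⊥
noThreeAmongTwo (inj₁ refl) (inj₁ refl) _           a≢b _   _   = a≢b refl
noThreeAmongTwo (inj₂ refl) (inj₂ refl) _           a≢b _   _   = a≢b refl
noThreeAmongTwo (inj₁ refl) (inj₂ refl) (inj₁ refl) _   a≢c _   = a≢c refl
noThreeAmongTwo (inj₁ refl) (inj₂ refl) (inj₂ refl) _   _   b≢c = b≢c refl
noThreeAmongTwo (inj₂ refl) (inj₁ refl) (inj₁ refl) _   _   b≢c = b≢c refl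
noThreeAmongTwo (inj₂ refl) (inj₁ refl) (inj₂ refl) _   a≢c _   = a≢c refl

module _ {A : Set} where

  Among₃ : A → A → A → A → Set
  Among₃ p q r x = x ≡ p ⊎ x ≡ q ⊎ x ≡ r

  rotate₃ : ∀ {p q r x} → Among₃ p q r x → Among₃ q r p x
  rotate₃ (inj₁ e)        = inj₂ (inj₂ e)
  rotate₃ (inj₂ (inj₁ e)) = inj₁ e
  rotate₃ (inj₂ (inj₂ e)) = inj₂ (inj₁ e)

  skipFirst : ∀ {p q r x} → Among₃ p q r x → p ≢ x → x ≡ q ⊎ x ≡ r
  skipFirst (inj₁ refl) p≢x = ⊥-elim (p≢x refl)
  skipFirst (inj₂ e)    _   = e

  noFourAmongThree-first : ∀ {p q r a b c d} → a ≡ p → Among₃ p q r b → Among₃ p q r c → Among₃ p q r d →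
                           a ≢ b → a ≢ c → a ≢ d → b ≢ c → b ≢ d → c ≢ d → ⊥
  noFourAmongThree-first refl bₓ cₓ dₓ a≢b a≢c a≢d =
    noThreeAmongTwo (skipFirst bₓ a≢b) (skipFirst cₓ a≢c) (skipFirst dₓ a≢d)

  noFourAmongThree : ∀ {p q r a b c d} → Among₃ p q r a → Among₃ p q r b → Among₃ p q r c → Among₃ p q r d →
                     a ≢ b → a ≢ c → a ≢ d → b ≢ c → b ≢ d → c ≢ d → ⊥
  noFourAmongThree (inj₁ a≡p)        bₓ cₓ dₓ = noFourAmongThree-first a≡p bₓ cₓ dₓ
  noFourAmongThree (inj₂ (inj₁ a≡q)) bₓ cₓ dₓ = noFourAmongThree-first a≡q (rotate₃ bₓ) (rotate₃ cₓ) (rotate₃ dₓ)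
  noFourAmongThree (inj₂ (inj₂ a≡r)) bₓ cₓ dₓ =
    noFourAmongThree-first a≡r (rotate₃ (rotate₃ bₓ)) (rotate₃ (rotate₃ cₓ)) (rotate₃ (rotate₃ dₓ))

-- An odd cycle is determined by its edges, since each of its vertices
-- lies on one of its edges.
oddCycle-ext : ∀ {n} {G : Graph n} {H K : Subgraph n} → OddCycleWalk G H → OddCycleWalk G K →
               (∀ {u w} → (u , w) ∈ₑ edges H → (u , w) ∈ₑ edges K) →
               (∀ {u w} → (u , w) ∈ₑ edges K → (u , w) ∈ₑ edges H) → H ≡ K
oddCycle-ext {G = G} {mkSub vH eH} {mkSub vK eK} h k H⊆K K⊆H =
  cong₂ mkSub (Subsetₚ.⊆-antisym (vertsBy h k H⊆K) (vertsBy k h K⊆H)) edges≡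
  where
  vertsBy : ∀ {H K} → OddCycleWalk G H → OddCycleWalk G K →
            (∀ {u w} → (u , w) ∈ₑ edges H → (u , w) ∈ₑ edges K) → verts H ⊆ verts K
  vertsBy h k sub x∈ with CycleEdge-at (OddCycleWalk.walk h) (OddCycleWalk.vertex⁺ h x∈)
  ... | w , p = OddCycleWalk.vertex⁻ k (proj₁ (CycleEdge-∈ (OddCycleWalk.walk k)
                  (OddCycleWalk.edge⁺ k (sub (OddCycleWalk.edge⁻ h p)))))
  edges≡ : eH ≡ eK
  edges≡ = begin
    eH                         ≡⟨ sym (Vecₚ.tabulate∘lookup eH) ⟩
    Vec.tabulate (Vec.lookup eH) ≡⟨ Vecₚ.tabulate-cong (λ u → Subsetₚ.⊆-antisym (H⊆K {u}) (K⊆H {u})) ⟩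
    Vec.tabulate (Vec.lookup eK) ≡⟨ Vecₚ.tabulate∘lookup eK ⟩
    eK                         ∎
    where open ≡-Reasoning

-- By `meet`, applied
-- to C and D in both orders, otherwise either G has two further odd
-- cycles, making four distinct odd cycles together with C and D, or C
-- and D have the same edges and so coincide.
lemma2p3 : ∀ {n : ℕ} (G : Graph n) → HasExactlyThreeOddCycles G →
    ∀ C D → IsOddCycle G C → IsOddCycle G D → C ≢ D →
    IsEmpty (C ∩ᵍ D) ⊎ IsPath (C ∩ᵍ D)
lemma2p3 G (_ , _ , _ , _ , _ , _ , _ , _ , _ , onlyThree) C D oddC oddD C≢D =
  settle (AroundCycle.meet G c d) (AroundCycle.meet G d c)
  where
  c = oddCycleWalk oddC
  d = oddCycleWalk oddD
  tooMany : ∀ {H K} (h : OddCycleWalk G H) → IsOddCycle G H → IsOddCycle G K → H ≢ K →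
            AroundCycle.TwoMore G h K → ⊥
  tooMany _ oddH oddK H≢K (_ , _ , odd₁ , odd₂ , K₁≢K₂ , K₁≢H , K₂≢H , K₁≢K , K₂≢K) =
    noFourAmongThree (onlyThree _ oddH) (onlyThree _ oddK) (onlyThree _ odd₁) (onlyThree _ odd₂)
      H≢K (≢-sym K₁≢H) (≢-sym K₂≢H) (≢-sym K₁≢K) (≢-sym K₂≢K) K₁≢K₂
  settle : AroundCycle.Outcome G c D ⊎ (∀ {u w} → (u , w) ∈ₑ edges D → (u , w) ∈ₑ edges C) →
           AroundCycle.Outcome G d C ⊎ (∀ {u w} → (u , w) ∈ₑ edges C → (u , w) ∈ₑ edges D) →
           IsEmpty (C ∩ᵍ D) ⊎ IsPath (C ∩ᵍ D)
  settle (inj₁ (inj₁ empty))        _                          = inj₁ empty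
  settle (inj₁ (inj₂ (inj₁ path)))  _                          = inj₂ path
  settle (inj₁ (inj₂ (inj₂ more)))  _                          = ⊥-elim (tooMany c oddC oddD C≢D more)
  settle (inj₂ _)   (inj₁ (inj₁ empty))       = inj₁ (subst IsEmpty (∩ᵍ-comm {H = D} {K = C}) empty)
  settle (inj₂ _)   (inj₁ (inj₂ (inj₁ path))) = inj₂ (subst IsPath (∩ᵍ-comm {H = D} {K = C}) path)
  settle (inj₂ _)   (inj₁ (inj₂ (inj₂ more))) = ⊥-elim (tooMany d oddD oddC (≢-sym C≢D) more)
  settle (inj₂ D⊆C) (inj₂ C⊆D)                = ⊥-elim (C≢D (oddCycle-ext c d C⊆D D⊆C))
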